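{- Let $\pi$ be a subset seed of span $m$ and let $S_\pi$ be its automaton. Let $q=\langle X,t\rangle$ be a non-final state of $S_\pi$ that is reachable from the initial state $\langle\emptyset,0\rangle$, where $X=\{l_{i_1},\dots,l_{i_k}\}$ is nonempty with $l_{i_1}<\dots<l_{i_k}$, and let $X'=X\setminus\{l_{i_k}\}$ and $q'=\langle X',t\rangle$. Then $q'$ is reachable from the initial state, and in a breadth-first computation of the states of $S_\pi$ starting from the initial state, $q'$ is processed before $q$.
   Context: Subset seeds: the alignment alphabet $\mathcal{A}$ is a finite alphabet containing a symbol $1$. The seed alphabet $\mathcal{B}$ is a set of letters each denoting a subset of $\mathcal{A}$ containing $1$, and contains a letter $\#$ denoting $\{1\}$. A subset seed is a word $\pi=\pi_1\cdots\pi_m\in\mathcal{B}^m$. A letter $a$ matches $\pi_x$ if $a\in\pi_x$. Let $R_\pi=\{l_1<\dots<l_r\}$ be the set of positions $i$ with $\pi_i\neq\#$, and $\max\emptyset=0$. The automaton $S_\pi$: its non-final states are pairs $\langle X,t\rangle$ with $X\subseteq R_\pi$, $t\in\{0,\dots,m\}$ and $\max X+t\le m-1$; there is additionally a single final state $q_F$, with every pair satisfying $\max X+t=m$ identified with $q_F$. Initial state $\langle\emptyset,0\rangle$. Transitions: $\psi(q_F,a)=q_F$; for non-final $q=\langle X,t\rangle$, $\psi(q,1)=\langle X,t+1\rangle$ and for $a\neq1$, $\psi(q,a)=\langle X_U\cup X_V,0\rangle$ with $X_U=\{x:x\le t+1,\ a\text{ matches }\pi_x\}$ and $X_V=\{x+t+1:x\in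 X,\ a\text{ matches }\pi_{x+t+1}\}$. A state is reachable if some word leads from the initial state to it. -}

module Defs where

open import Data.Nat using (ℕ; zero; suc; _+_; _∸_; _⊔_; _≤ᵇ_; _≡ᵇ_)
open import Data.Bool using (Bool; true; false; _∧_; _∨_; not; if_then_else_)
open import Data.Fin using (Fin; toℕ; _≟_)
open import Data.Fin.Subset using (Subset; _∈_; ⁅_⁆; _∪_; ⊥)
open import Data.Vec using (Vec; lookup; tabulate)
open import Data.List using (List; []; _∷_; foldr; foldl; map; length)
open import Data.List.Base using (allFin)
open import Data.Product using (Σ; _×_)
open import Relation.Nullary using (¬_; yes; no)
open import Relation.Binary.PropositionalEquality using (_≡_)

-- Alignment alphabet: Fin k, with a designated symbol `one` (the letter 1).
-- A seed letter is (identified with) a subset of the alignment alphabet containing 1.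
record SeedLetter (k : ℕ) (one : Fin k) : Set where
  constructor letter
  field
    set  : Subset k
    has1 : one ∈ set
open SeedLetter public

IsHash : ∀ {k} {one : Fin k} → SeedLetter k one → Set
IsHash {one = one} ℓ = set ℓ ≡ ⁅ one ⁆

matches : ∀ {k} {one : Fin k} → Fin k → SeedLetter k one → Bool
matches a ℓ = lookup (set ℓ) a

-- Subsets X of positions {1..m}: index i : Fin m stands for position toℕ i + 1.
pos : ∀ {m} → Fin m → ℕ
pos i = suc (toℕ i)

-- membership of a position (a natural number) in X; positions outside 1..m are never members
memPos : ∀ {m} → Subset m → ℕ → Bool
memPos {m} X p = foldr _∨_ false (map (λ i → lookup X i ∧ (pos i ≡ᵇ p)) (allFin m))

-- max X, with max ∅ = 0
maxPos : ∀ {m} → Subset m → ℕ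
maxPos {m} X = foldr _⊔_ 0 (map (λ i → if lookup X i then pos i else 0) (allFin m))

dropMax : ∀ {m} → Subset m → Subset m
dropMax X = tabulate (λ i → lookup X i ∧ not (pos i ≡ᵇ maxPos X))

data State (m : ℕ) : Set where
  qF : State m
  st : Subset m → ℕ → State m

InR : ∀ {k m} {one : Fin k} → Vec (SeedLetter k one) m → Fin m → Set
InR π i = ¬ IsHash (lookup π i)

NonFinalState : ∀ {k m} {one : Fin k} → Vec (SeedLetter k one) m → Subset m → ℕ → Set
NonFinalState {m = m} π X t =
  (∀ i → lookup X i ≡ true → InR π i) × (suc (maxPos X + t) Data.Nat.≤ m)

-- pairs with max X + t = m (or more; never produced) are identified with q_F
normalize : ∀ {m} → Subset m → ℕ → State m
normalize {m} X t = if m ≤ᵇ maxPos X + t then qF else st X t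

initial : ∀ {m} → State m
initial = st ⊥ 0

ψ : ∀ {k m} {one : Fin k} → Vec (SeedLetter k one) m → State m → Fin k → State m
ψ π qF a = qF
ψ {one = one} π (st X t) a with a ≟ one
... | yes _ = normalize X (suc t)
... | no  _ = normalize (XU ∪ XV) 0
  where
  XU = tabulate (λ i → (pos i ≤ᵇ suc t) ∧ matches a (lookup π i))
  -- x + t + 1 with x ∈ X  ⇔  position p with p ∸ (t+1) ∈ X and p > t+1
  XV = tabulate (λ i → (suc t Data.Nat.<ᵇ pos i) ∧ memPos X (pos i ∸ suc t) ∧ matches a (lookup π i))

run : ∀ {k m} {one : Fin k} → Vec (SeedLetter k one) m → List (Fin k) → State m
run π w = foldl (ψ π) initial w

Reachable : ∀ {k m} {one : Fin k} → Vec (SeedLetter k one) m → State m → Set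
Reachable {k} π q = Σ (List (Fin k)) λ w → run π w ≡ q

ReachableIn : ∀ {k m} {one : Fin k} → Vec (SeedLetter k one) m → ℕ → State m → Set
ReachableIn {k} π n q = Σ (List (Fin k)) λ w → length w ≡ n × run π w ≡ q

-- BFS processes q' strictly before q whenever the BFS depth (shortest word length)
-- of q' is strictly smaller than that of q.
ProcessedBefore : ∀ {k m} {one : Fin k} → Vec (SeedLetter k one) m → State m → State m → Set
ProcessedBefore π q' q =
  Σ ℕ λ n → ReachableIn π n q' × (∀ n' → ReachableIn π n' q → n Data.Nat.< n')

-- Reading the last j letters of a word from the initial state lands in the
-- "window" of the state reached by the whole word: an element x of X survives
-- iff x + t ≤ j, and the run of 1s is capped at j.  Hence a word reaching ⟨X,t⟩
-- has length at least max X + t, and the suffix of length max X − 1 + t of such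
-- a word reaches ⟨X ∖ {max X}, t⟩ — strictly shorter, so at a strictly smaller
-- breadth-first depth.
module Submission where

open import Defs
open import Data.Nat using (ℕ)
open import Data.Fin using (Fin)
open import Data.Fin.Subset using (Subset; Nonempty)
open import Data.Vec using (Vec)
open import Data.Product using (_×_)

open import Data.Bool using (Bool; true; false; T; _∧_; not; if_then_else_)
open import Data.Bool.Properties using (T-∧; T-≡)
open import Data.Empty using (⊥-elim)
open import Data.Fin using (_≟_; toℕ)
open import Data.Fin.Subset using (_∈_; _⊆_; _∩_; _∪_; ⊥)
open import Data.Fin.Subset.Properties
  using (∉⊥; ⊥⊆; ⊆-antisym; x∈p∩q⁺; x∈p∩q⁻; p∩q⊆p; ∩-distribʳ-∪)
open import Data.List using (List; []; _∷_; _++_; foldl; foldr; map; length; take; drop; allFin)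
open import Data.List.Properties using (foldl-++; length-drop; take++drop≡id)
import Data.List.Membership.Propositional as List
open import Data.List.Membership.Propositional.Properties using (∈-allFin)
open import Data.List.Relation.Unary.Any using (here; there; satisfied)
open import Data.List.Relation.Unary.Any.Properties using (any⁺; any⁻)
open import Data.Nat
  using (suc; pred; _+_; _∸_; _⊔_; _⊓_; _≤_; _<_; _≤ᵇ_; _<ᵇ_; z≤n; s≤s; >-nonZero)
open import Data.Nat.Properties hiding (_≟_)
open import Data.Product using (∃; _,_; proj₁; proj₂)
open import Data.Sum using (inj₁; inj₂)
open import Data.Unit using (tt)
open import Data.Vec using (lookup; tabulate)
open import Data.Vec.Properties using (lookup∘tabulate; []=⇒lookup; lookup⇒[]=)
open import Function.Base using (_∘_)
open import Function.Bundles using (Equivalence)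
open import Relation.Nullary using (¬_; yes; no)
open import Relation.Binary.PropositionalEquality
open ≡-Reasoning

open Equivalence using (to; from)

T-not⇒¬T : ∀ {b} → T (not b) → ¬ T b
T-not⇒¬T {true} () _

¬T⇒T-not : ∀ {b} → ¬ T b → T (not b)
¬T⇒T-not {true}  ¬b = ¬b tt
¬T⇒T-not {false} _  = tt

∈-tabulate⁻ : ∀ {m} {f : Fin m → Bool} {i} → i ∈ tabulate f → T (f i)
∈-tabulate⁻ {f = f} {i} i∈ =
  from T-≡ (trans (sym (lookup∘tabulate f i)) ([]=⇒lookup i∈))

∈-tabulate⁺ : ∀ {m} {f : Fin m → Bool} {i} → T (f i) → i ∈ tabulate f
∈-tabulate⁺ {f = f} {i} fi = lookup⇒[]= i _ (trans (lookup∘tabulate f i) (to T-≡ fi))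

foldr-⊔-upper : ∀ {A : Set} (g : A → ℕ) {x xs} → x List.∈ xs → g x ≤ foldr _⊔_ 0 (map g xs)
foldr-⊔-upper g (here refl) = m≤m⊔n _ _
foldr-⊔-upper g {xs = y ∷ _} (there x∈) = ≤-trans (foldr-⊔-upper g x∈) (m≤n⊔m (g y) _)

foldr-⊔-least : ∀ {A : Set} (g : A → ℕ) {b} xs → (∀ x → g x ≤ b) → foldr _⊔_ 0 (map g xs) ≤ b
foldr-⊔-least g []       g≤b = z≤n
foldr-⊔-least g (x ∷ xs) g≤b = ⊔-lub (g≤b x) (foldr-⊔-least g xs g≤b)

module _ {m : ℕ} where

  atMost : ℕ → Subset m
  atMost n = tabulate (λ i → pos i ≤ᵇ n)

  ∈-atMost⁻ : ∀ {n i} → i ∈ atMost n → pos i ≤ n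
  ∈-atMost⁻ i∈ = ≤ᵇ⇒≤ _ _ (∈-tabulate⁻ i∈)

  ∈-atMost⁺ : ∀ {n i} → pos i ≤ n → i ∈ atMost n
  ∈-atMost⁺ le = ∈-tabulate⁺ (≤⇒≤ᵇ le)

  ∩-atMost-zero : (X : Subset m) → X ∩ atMost 0 ≡ ⊥
  ∩-atMost-zero X = ⊆-antisym (λ i∈ → ⊥-elim (n≮0 (∈-atMost⁻ (proj₂ (x∈p∩q⁻ X _ i∈))))) ⊥⊆

  memPos-sound : ∀ {X : Subset m} {p} → T (memPos X p) → ∃ λ i → i ∈ X × pos i ≡ p
  memPos-sound {X} {p} h with satisfied (any⁻ _ (allFin m) h)
  ... | i , hi = let (i∈X , eq) = to T-∧ hi in i , lookup⇒[]= i X (to T-≡ i∈X) , ≡ᵇ⇒≡ _ _ eq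

  memPos-complete : ∀ {X : Subset m} {i} → i ∈ X → T (memPos X (pos i))
  memPos-complete {X} {i} i∈X =
    any⁺ _ (List.lose (∈-allFin i) (from T-∧ (from T-≡ ([]=⇒lookup i∈X) , ≡⇒≡ᵇ (pos i) _ refl)))

  maxPos-upper : ∀ {X : Subset m} {i} → i ∈ X → pos i ≤ maxPos X
  maxPos-upper {X} {i} i∈X =
    subst (_≤ maxPos X) (cong (λ b → if b then pos i else 0) ([]=⇒lookup i∈X))
      (foldr-⊔-upper (λ j → if lookup X j then pos j else 0) (∈-allFin i))

  maxPos-least : ∀ {X : Subset m} {b} → (∀ {i} → i ∈ X → pos i ≤ b) → maxPos X ≤ b
  maxPos-least {X} {b} bound = foldr-⊔-least _ (allFin m) entry
    where
    entry : ∀ i → (if lookup X i then pos i else 0) ≤ b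
    entry i with lookup X i in eq
    ... | true  = bound (lookup⇒[]= i X eq)
    ... | false = z≤n

  maxPos-mono : ∀ {X Y : Subset m} → X ⊆ Y → maxPos X ≤ maxPos Y
  maxPos-mono X⊆Y = maxPos-least (λ i∈X → maxPos-upper (X⊆Y i∈X))

  dropMax≡∩atMost : (X : Subset m) → dropMax X ≡ X ∩ atMost (pred (maxPos X))
  dropMax≡∩atMost X = ⊆-antisym dropped⊆ ⊆dropped
    where
    dropped⊆ : dropMax X ⊆ X ∩ atMost (pred (maxPos X))
    dropped⊆ i∈ =
      let (i∈X , i≢max) = to T-∧ (∈-tabulate⁻ i∈)
          i∈X′ = lookup⇒[]= _ X (to T-≡ i∈X)
          i<max = ≤∧≢⇒< (maxPos-upper i∈X′) (λ eq → T-not⇒¬T i≢max (≡⇒≡ᵇ _ _ eq))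
      in x∈p∩q⁺ (i∈X′ , ∈-atMost⁺ (suc[m]≤n⇒m≤pred[n] i<max))
    ⊆dropped : X ∩ atMost (pred (maxPos X)) ⊆ dropMax X
    ⊆dropped {i} i∈ =
      let (i∈X , i∈atMost) = x∈p∩q⁻ X _ i∈
          i≢max : pos i ≢ maxPos X
          i≢max eq = 1+n≰n (subst (λ n → pos i ≤ pred n) (sym eq) (∈-atMost⁻ i∈atMost))
      in ∈-tabulate⁺ (from T-∧ (from T-≡ ([]=⇒lookup i∈X) , ¬T⇒T-not (i≢max ∘ ≡ᵇ⇒≡ _ _)))

st-injective : ∀ {m} {X Y : Subset m} {t s} → st X t ≡ st Y s → X ≡ Y × t ≡ s
st-injective refl = refl , refl

module Automaton {k m : ℕ} {one : Fin k} (π : Vec (SeedLetter k one) m) where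

  Matches : Fin k → Fin m → Set
  Matches a i = T (matches a (lookup π i))

  XU : ℕ → Fin k → Subset m
  XU t a = tabulate (λ i → (pos i ≤ᵇ suc t) ∧ matches a (lookup π i))

  XV : Subset m → ℕ → Fin k → Subset m
  XV X t a = tabulate (λ i → (suc t <ᵇ pos i) ∧ memPos X (pos i ∸ suc t) ∧ matches a (lookup π i))

  ∈-XU⁻ : ∀ {t a i} → i ∈ XU t a → pos i ≤ suc t × Matches a i
  ∈-XU⁻ i∈ = let (le , ma) = to T-∧ (∈-tabulate⁻ i∈) in ≤ᵇ⇒≤ _ _ le , ma

  ∈-XU⁺ : ∀ {t a i} → pos i ≤ suc t → Matches a i → i ∈ XU t a
  ∈-XU⁺ le ma = ∈-tabulate⁺ (from T-∧ (≤⇒≤ᵇ le , ma))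

  Shifted : Subset m → ℕ → Fin m → Set
  Shifted X t i = ∃ λ j → j ∈ X × pos j + suc t ≡ pos i

  ∈-XV⁻ : ∀ {X t a i} → i ∈ XV X t a → Shifted X t i × Matches a i
  ∈-XV⁻ {X} {t} {i = i} i∈ with to (T-∧ {suc t <ᵇ pos i}) (∈-tabulate⁻ i∈)
  ... | lt , rest with to (T-∧ {memPos X (pos i ∸ suc t)}) rest
  ... | mem , ma with memPos-sound {X = X} {p = pos i ∸ suc t} mem
  ... | j , j∈X , eq =
    (j , j∈X , trans (cong (_+ suc t) eq) (m∸n+n≡m (<⇒≤ (<ᵇ⇒< (suc t) (pos i) lt)))) , ma

  ∈-XV⁺ : ∀ {X t a i} → Shifted X t i → Matches a i → i ∈ XV X t a
  ∈-XV⁺ {X} {t} {i = i} (j , j∈X , eq) ma =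
    ∈-tabulate⁺ (from (T-∧ {suc t <ᵇ pos i}) (<⇒<ᵇ lt , from T-∧ (mem , ma)))
    where
    lt : suc t < pos i
    lt = subst (suc t <_) eq (s≤s (m≤n+m (suc t) (toℕ j)))
    mem : T (memPos X (pos i ∸ suc t))
    mem = subst (λ p → T (memPos X p)) (trans (sym (m+n∸n≡m (pos j) (suc t))) (cong (_∸ suc t) eq))
            (memPos-complete j∈X)

  XV-⊥ : ∀ t a → XV ⊥ t a ≡ ⊥
  XV-⊥ t a = ⊆-antisym (λ i∈ → ⊥-elim (∉⊥ (proj₁ (proj₂ (proj₁ (∈-XV⁻ {X = ⊥} i∈)))))) ⊥⊆

  XU-∩-atMost : ∀ n t a → XU t a ∩ atMost (suc n) ≡ XU (n ⊓ t) a
  XU-∩-atMost n t a = ⊆-antisym cut⊆ ⊆cut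
    where
    cut⊆ : XU t a ∩ atMost (suc n) ⊆ XU (n ⊓ t) a
    cut⊆ i∈ = let (i∈XU , i∈atMost) = x∈p∩q⁻ (XU t a) _ i∈
                  (le , ma) = ∈-XU⁻ i∈XU
              in ∈-XU⁺ (⊓-glb (∈-atMost⁻ i∈atMost) le) ma
    ⊆cut : XU (n ⊓ t) a ⊆ XU t a ∩ atMost (suc n)
    ⊆cut i∈ = let (le , ma) = ∈-XU⁻ i∈ in
      x∈p∩q⁺ (∈-XU⁺ (≤-trans le (s≤s (m⊓n≤n n t))) ma , ∈-atMost⁺ (≤-trans le (s≤s (m⊓n≤m n t))))

  XV-∩-atMost : ∀ X n t a → XV X t a ∩ atMost n ≡ XV (X ∩ atMost (n ∸ suc t)) t a
  XV-∩-atMost X n t a = ⊆-antisym cut⊆ ⊆cut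
    where
    cut⊆ : XV X t a ∩ atMost n ⊆ XV (X ∩ atMost (n ∸ suc t)) t a
    cut⊆ i∈ with x∈p∩q⁻ (XV X t a) _ i∈
    ... | i∈XV , i∈atMost with ∈-XV⁻ {X = X} i∈XV
    ... | (j , j∈X , eq) , ma = ∈-XV⁺ {X = X ∩ atMost (n ∸ suc t)} (j , x∈p∩q⁺ (j∈X , ∈-atMost⁺ j≤) , eq) ma
      where
      j≤ : pos j ≤ n ∸ suc t
      j≤ = m+n≤o⇒m≤o∸n (pos j) (subst (_≤ n) (sym eq) (∈-atMost⁻ i∈atMost))
    ⊆cut : XV (X ∩ atMost (n ∸ suc t)) t a ⊆ XV X t a ∩ atMost n
    ⊆cut i∈ with ∈-XV⁻ {X = X ∩ atMost (n ∸ suc t)} i∈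
    ... | (j , j∈cut , eq) , ma with x∈p∩q⁻ X _ j∈cut
    ... | j∈X , j∈atMost =
      x∈p∩q⁺ (∈-XV⁺ {X = X} (j , j∈X , eq) ma , ∈-atMost⁺ (subst (_≤ n) eq shifted≤n))
      where
      j≤ : pos j ≤ n ∸ suc t
      j≤ = ∈-atMost⁻ j∈atMost
      shifted≤n : pos j + suc t ≤ n
      shifted≤n = m≤o∸n⇒m+n≤o (pos j) (<⇒≤ (m∸n≢0⇒n<m (λ z → n≮0 (subst (pos j ≤_) z j≤)))) j≤

  XV-∩-atMost-⊓ : ∀ X j t a → XV (X ∩ atMost (j ∸ t)) t a ≡ XV (X ∩ atMost (j ∸ t)) (j ⊓ t) a
  XV-∩-atMost-⊓ X j t a with ≤-total t j
  ... | inj₁ t≤j rewrite m≥n⇒m⊓n≡n t≤j = refl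
  ... | inj₂ j≤t rewrite m≤n⇒m∸n≡0 j≤t | ∩-atMost-zero X = trans (XV-⊥ t a) (sym (XV-⊥ (j ⊓ t) a))

  XU∪XV-∩-atMost : ∀ X j t a →
    (XU t a ∪ XV X t a) ∩ atMost (suc j) ≡ XU (j ⊓ t) a ∪ XV (X ∩ atMost (j ∸ t)) (j ⊓ t) a
  XU∪XV-∩-atMost X j t a = begin
    (XU t a ∪ XV X t a) ∩ atMost (suc j)
      ≡⟨ ∩-distribʳ-∪ (atMost (suc j)) (XU t a) (XV X t a) ⟩
    XU t a ∩ atMost (suc j) ∪ XV X t a ∩ atMost (suc j)
      ≡⟨ cong₂ _∪_ (XU-∩-atMost j t a) (XV-∩-atMost X (suc j) t a) ⟩
    XU (j ⊓ t) a ∪ XV (X ∩ atMost (j ∸ t)) t a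
      ≡⟨ cong (XU (j ⊓ t) a ∪_) (XV-∩-atMost-⊓ X j t a) ⟩
    XU (j ⊓ t) a ∪ XV (X ∩ atMost (j ∸ t)) (j ⊓ t) a ∎

  normalize-st⁻ : ∀ {X Y : Subset m} {t s} → normalize X t ≡ st Y s → maxPos X + t < m × X ≡ Y × t ≡ s
  normalize-st⁻ {X} {t = t} eq with m ≤ᵇ maxPos X + t in notFinal
  normalize-st⁻ () | true
  normalize-st⁻ refl | false = ≰⇒> (λ le → subst T notFinal (≤⇒≤ᵇ le)) , refl , refl

  normalize-⊆ : ∀ {X Y : Subset m} {t s} → Y ⊆ X → s ≤ t → maxPos X + t < m → normalize Y s ≡ st Y s
  normalize-⊆ {X} {Y} {t} {s} Y⊆X s≤t bound with m ≤ᵇ maxPos Y + s in final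
  ... | false = refl
  ... | true  = ⊥-elim (<⇒≱ (≤-<-trans (+-mono-≤ (maxPos-mono Y⊆X) s≤t) bound)
                              (≤ᵇ⇒≤ m _ (subst T (sym final) tt)))

  foldl-qF≢st : ∀ {X t} s → foldl (ψ π) qF s ≢ st X t
  foldl-qF≢st []      ()
  foldl-qF≢st (a ∷ s) = foldl-qF≢st s

  window : ℕ → Subset m → ℕ → State m
  window j X t = st (X ∩ atMost (j ∸ t)) (j ⊓ t)

  window-zero : ∀ X t → window 0 X t ≡ initial
  window-zero X t rewrite 0∸n≡0 t = cong (λ Y → st Y 0) (∩-atMost-zero X)

  window-+ : ∀ j X t → window (j + t) X t ≡ st (X ∩ atMost j) t
  window-+ j X t = cong₂ st (cong (λ n → X ∩ atMost n) (m+n∸n≡m j t)) (m≥n⇒m⊓n≡n (m≤n+m t j))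

  ψ-window : ∀ {X X′ t t′} j a → ψ π (st X t) a ≡ st X′ t′ → ψ π (window j X t) a ≡ window (suc j) X′ t′
  ψ-window {X} {t = t} j a eq with a ≟ one
  ... | yes _ with normalize-st⁻ eq
  -- window (suc j) X (suc t) is definitionally st (X ∩ atMost (j ∸ t)) (suc (j ⊓ t)).
  ...   | bound , refl , refl = normalize-⊆ (p∩q⊆p X _) (s≤s (m⊓n≤n j t)) bound
  ψ-window {X} {t = t} j a eq | no _ with normalize-st⁻ eq
  ...   | bound , refl , refl = begin
    normalize (XU (j ⊓ t) a ∪ XV (X ∩ atMost (j ∸ t)) (j ⊓ t) a) 0
      ≡⟨ cong (λ Y → normalize Y 0) (sym (XU∪XV-∩-atMost X j t a)) ⟩
    normalize ((XU t a ∪ XV X t a) ∩ atMost (suc j)) 0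
      ≡⟨ normalize-⊆ (p∩q⊆p _ _) z≤n bound ⟩
    st ((XU t a ∪ XV X t a) ∩ atMost (suc j)) 0 ∎

  foldl-window : ∀ {X X′ t t′} j s → foldl (ψ π) (st X t) s ≡ st X′ t′ →
                 foldl (ψ π) (window j X t) s ≡ window (j + length s) X′ t′
  foldl-window {X} {t = t} j [] refl = cong (λ n → window n X t) (sym (+-identityʳ j))
  foldl-window {X} {X′} {t} {t′} j (a ∷ s) eq with ψ π (st X t) a in step
  ... | qF = ⊥-elim (foldl-qF≢st s eq)
  ... | st X₁ t₁ = begin
    foldl (ψ π) (ψ π (window j X t) a) s  ≡⟨ cong (λ q → foldl (ψ π) q s) (ψ-window j a step) ⟩
    foldl (ψ π) (window (suc j) X₁ t₁) s  ≡⟨ foldl-window (suc j) s eq ⟩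
    window (suc j + length s) X′ t′       ≡⟨ cong (λ n → window n X′ t′) (sym (+-suc j (length s))) ⟩
    window (j + suc (length s)) X′ t′     ∎

  suffix-window : ∀ {X t} q s → foldl (ψ π) q s ≡ st X t → run π s ≡ window (length s) X t
  suffix-window qF s eq = ⊥-elim (foldl-qF≢st s eq)
  suffix-window (st Y u) s eq =
    trans (cong (λ q → foldl (ψ π) q s) (sym (window-zero Y u))) (foldl-window 0 s eq)

  run-length : ∀ {X t} w → run π w ≡ st X t → maxPos X + t ≤ length w
  run-length {X} {t} w eq with st-injective (trans (sym eq) (suffix-window initial w eq))
  ... | X≡ , t≡ = m≤o∸n⇒m+n≤o (maxPos X) t≤ (maxPos-least inWindow)
    where
    t≤ : t ≤ length w
    t≤ = subst (_≤ length w) (sym t≡) (m⊓n≤m (length w) t)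
    inWindow : ∀ {i} → i ∈ X → pos i ≤ length w ∸ t
    inWindow i∈X = ∈-atMost⁻ (proj₂ (x∈p∩q⁻ X _ (subst (_ ∈_) X≡ i∈X)))

lemma7 : ∀ {k m} (one : Fin k) (π : Vec (SeedLetter k one) m) (X : Subset m) (t : ℕ) →
         NonFinalState π X t → Nonempty X → Reachable π (st X t) →
         Reachable π (st (dropMax X) t) × ProcessedBefore π (st (dropMax X) t) (st X t)
lemma7 one π X t _ (i , i∈X) (w , w↦X) = (s , s↦X′) , n , (s , length-s , s↦X′) , shallower
  where
  open Automaton π
  l = maxPos X
  n = pred l + t
  n<depth : n < l + t
  n<depth = +-monoˡ-< t (≤-reflexive (suc-pred l {{>-nonZero (≤-trans (s≤s z≤n) (maxPos-upper i∈X))}}))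
  d = length w ∸ n
  s = drop d w
  length-s : length s ≡ n
  length-s = trans (length-drop d w) (m∸[m∸n]≡n (<⇒≤ (<-≤-trans n<depth (run-length w w↦X))))
  prefix-then-s↦X : foldl (ψ π) (run π (take d w)) s ≡ st X t
  prefix-then-s↦X = begin
    foldl (ψ π) (run π (take d w)) s  ≡⟨ sym (foldl-++ (ψ π) initial (take d w) s) ⟩
    run π (take d w ++ s)             ≡⟨ cong (run π) (take++drop≡id d w) ⟩
    run π w                           ≡⟨ w↦X ⟩
    st X t                            ∎
  s↦X′ : run π s ≡ st (dropMax X) t
  s↦X′ = begin
    run π s                       ≡⟨ suffix-window (run π (take d w)) s prefix-then-s↦X ⟩
    window (length s) X t         ≡⟨ cong (λ j → window j X t) length-s ⟩
    window (pred l + t) X t       ≡⟨ window-+ (pred l) X t ⟩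
    st (X ∩ atMost (pred l)) t    ≡⟨ cong (λ Y → st Y t) (sym (dropMax≡∩atMost X)) ⟩
    st (dropMax X) t              ∎
  shallower : ∀ n′ → ReachableIn π n′ (st X t) → n < n′
  shallower _ (w′ , refl , w′↦X) = <-≤-trans n<depth (run-length w′ w′↦X)
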